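{- Let $G$ be the geometric graph described in the context, and let $G[i,j]$ be an interval of $G$ with at least two vertices. Then $G[i,j]$ contains a spanning star centered at its highest vertex $v_k$, and a spanning star centered at its second highest vertex $v_s$. Moreover, if $k<j$, then $G[i,j]$ contains a spanning star centered at the highest vertex of $G[k+1,j]$.
   Context: Let $H\ge 2$ and $n=2^H-1$. Let $B$ be a complete rooted ordered binary tree on $n$ vertices. A level is a set of vertices at the same distance from the root. The preorder traversal of $B$ (root, then recursively the left subtree, then recursively the right subtree) gives a total order on the vertices and on each level; two consecutive vertices of the same level in this order are level-neighbors (left and right level-neighbor). For a vertex $v$, $B(v)$ is the subtree of $B$ rooted at $v$. The graph $G$ consists of the edges of $B$ together with: (E1) every vertex $v$ is adjacent to all vertices of $B(v)$; (E2) every vertex $v$ with a left or right level-neighbor $u$ is adjacent to all vertices of $B(u)$; (E3) every vertex $v$ whose parent has a left level-neighbor $p$ is adjacent to all vertices of $B(p)$. Vertices are placed in the plane as follows: the $x$-coordinates are $0,\dots,n-1$ in preorder, and $v_i$ denotes the vertex with $x$-coordinate $i$; the $y$-coordinates are distinct and ordered by a BFS traversal of $B$ from the root in which, at every vertex, the right child is visited before the left child: a vertex visited earlier gets a larger $y$-coordinate ("higher"). Moreover, the $y$-coordinates are chosen so that every vertex lies strictly above every line through two vertices with smaller $y$-coordinates (so the points are in general position). Edges are straight-line segments. For integers $0\le i\le j\le n-1$, the interval $G[i,j]$ is the subgraph of $G$ induced by $v_i,\dots,v_j$. A spanning star of $G[i,j]$ centered at $v$ is a set of edges of $G[i,j]$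 joining $v$ to every other vertex of $G[i,j]$. -}

module Defs where

open import Data.Nat using (ℕ; zero; suc; _+_; _∸_; _^_; _≤_; _<_)
open import Data.Bool using (Bool; true; false)
open import Data.List using (List; []; _∷_; _++_; length)
open import Data.Product using (Σ; _×_; _,_)
open import Data.Sum using (_⊎_)
open import Relation.Binary.PropositionalEquality using (_≡_)
open import Relation.Nullary using (¬_)

-- A vertex of the complete binary tree B of height H (H levels, 2^H - 1
-- vertices) is the path from the root: false = go to left child,
-- true = go to right child.  The root is [].
Vertex : Set
Vertex = List Bool

IsVertex : ℕ → Vertex → Set
IsVertex H v = length v < H

depth : Vertex → ℕ
depth = length

-- preorder index (x-coordinate) of a path inside a complete subtree of
-- height h: root gets 0, left subtree (2^(h-1) - 1 vertices) comes next,
-- then the right subtree starting at 2^(h-1).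
pre : ℕ → Vertex → ℕ
pre h []            = 0
pre h (false ∷ p)   = 1 + pre (h ∸ 1) p
pre h (true ∷ p)    = 2 ^ (h ∸ 1) + pre (h ∸ 1) p

xc : ℕ → Vertex → ℕ
xc H v = pre H v

InSubtree : Vertex → Vertex → Set
InSubtree u v = Σ (List Bool) λ s → u ≡ v ++ s

ParentOf : Vertex → Vertex → Set
ParentOf p c = Σ Bool λ b → c ≡ p ++ (b ∷ [])

LeftLevelNeighbour : ℕ → Vertex → Vertex → Set
LeftLevelNeighbour H u v =
  IsVertex H u × IsVertex H v × depth u ≡ depth v × xc H u < xc H v ×
  ((w : Vertex) → IsVertex H w → depth w ≡ depth v →
     ¬ (xc H u < xc H w × xc H w < xc H v))

LevelNeighbour : ℕ → Vertex → Vertex → Set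
LevelNeighbour H u v = LeftLevelNeighbour H u v ⊎ LeftLevelNeighbour H v u

-- the "directed" generating rules: v is joined to u because of
--   a tree edge, (E1), (E2) or (E3) applied at v.
Rule : ℕ → Vertex → Vertex → Set
Rule H v u =
  ParentOf v u ⊎ ParentOf u v
  ⊎ InSubtree u v
  ⊎ (Σ Vertex λ w → LevelNeighbour H w v × InSubtree u w)
  ⊎ (Σ Vertex λ q → Σ Vertex λ p →
       ParentOf q v × LeftLevelNeighbour H p q × InSubtree u p)

Adj : ℕ → Vertex → Vertex → Set
Adj H u v = IsVertex H u × IsVertex H v × ¬ (u ≡ v) × (Rule H u v ⊎ Rule H v u)

-- u is higher (larger y-coordinate) than v: y-order is the BFS order from
-- the root visiting the right child before the left child, i.e. levels
-- top-down, each level from right to left (decreasing preorder).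
Higher : ℕ → Vertex → Vertex → Set
Higher H u v = depth u < depth v ⊎ (depth u ≡ depth v × xc H v < xc H u)

InInterval : ℕ → ℕ → ℕ → Vertex → Set
InInterval H i j v = IsVertex H v × i ≤ xc H v × xc H v ≤ j

IsHighest : ℕ → ℕ → ℕ → Vertex → Set
IsHighest H i j v = InInterval H i j v ×
  ((u : Vertex) → InInterval H i j u → ¬ (u ≡ v) → Higher H v u)

IsSecondHighest : ℕ → ℕ → ℕ → Vertex → Vertex → Set
IsSecondHighest H i j k s = IsHighest H i j k × InInterval H i j s × ¬ (s ≡ k) ×
  ((u : Vertex) → InInterval H i j u → ¬ (u ≡ k) → ¬ (u ≡ s) → Higher H s u)

SpanningStar : ℕ → ℕ → ℕ → Vertex → Set
SpanningStar H i j c = InInterval H i j c ×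
  ((u : Vertex) → InInterval H i j u → ¬ (u ≡ c) → Adj H c u)

-- Let k be the highest vertex of the interval.  Every other interval vertex lies in B(k), or k
-- is a right child and the vertex lies in the subtree of its left sibling, which is k's left
-- level-neighbour: in any other position the interval would contain a vertex higher than k.
-- Hence k is a centre by (E1) and (E2).  The highest interval vertex strictly below k is a child
-- of k, and a left child only when the interval misses the right subtree of k; it reaches k by a
-- tree edge, B(k) by (E1) and (E2), and the left sibling's subtree by (E3).  The vertex of the
-- third claim is this child, and so is the second highest vertex unless that one lies in the left
-- sibling's subtree, where it is the highest vertex of the part of the interval before k.
module Submission where

open import Defs
open import Data.Nat using (ℕ; suc; pred; _+_; _∸_; _^_; _≤_; _<_; z≤n; s≤s; >-nonZero)
open import Data.Nat.Properties
open import Data.Bool using (true; false)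
open import Data.List using ([]; _∷_; _++_; length)
open import Data.List.Properties using (length-++; ++-assoc; ++-identityʳ)
open import Data.Product using (_×_; _,_; proj₁; proj₂)
open import Data.Sum using (inj₁; inj₂)
open import Data.Empty using (⊥-elim)
open import Relation.Binary.PropositionalEquality
open import Relation.Nullary using (¬_)

length-<-++-∷ : ∀ (u : Vertex) b s → length u < length (u ++ b ∷ s)
length-<-++-∷ []      b s = s≤s z≤n
length-<-++-∷ (_ ∷ u) b s = s≤s (length-<-++-∷ u b s)

length-≤-++ : ∀ (u s : Vertex) → length u ≤ length (u ++ s)
length-≤-++ []      s = z≤n
length-≤-++ (_ ∷ u) s = s≤s (length-≤-++ u s)

length-swap : ∀ (p : Vertex) x y s → length (p ++ x ∷ s) ≡ length (p ++ y ∷ s)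
length-swap []      x y s = refl
length-swap (_ ∷ p) x y s = cong suc (length-swap p x y s)

length-∷ʳ≤ : ∀ (m m' : Vertex) x y r → length m ≡ length m' →
             length (m ++ x ∷ []) ≤ length (m' ++ y ∷ r)
length-∷ʳ≤ m m' x y r e rewrite length-++ m {x ∷ []} | length-++ m' {y ∷ r} =
  +-mono-≤ (≤-reflexive e) (s≤s z≤n)

length-∷ʳ< : ∀ (m : Vertex) x y c r → length (m ++ x ∷ []) < length (m ++ y ∷ c ∷ r)
length-∷ʳ< []      x y c r = s≤s (s≤s z≤n)
length-∷ʳ< (_ ∷ m) x y c r = s≤s (length-∷ʳ< m x y c r)

descendant-≢ : ∀ k b r → ¬ k ++ b ∷ r ≡ k
descendant-≢ k b r e = <-irrefl (cong length (sym e)) (length-<-++-∷ k b r)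

InSubtree-child : ∀ k b s → InSubtree (k ++ b ∷ s) (k ++ b ∷ [])
InSubtree-child k b s = s , sym (++-assoc k (b ∷ []) s)

pre-ancestor-< : ∀ h m b r → pre h m < pre h (m ++ b ∷ r)
pre-ancestor-< h []          false r = s≤s z≤n
pre-ancestor-< h []          true  r = ≤-trans (m^n>0 2 (h ∸ 1)) (m≤m+n _ _)
pre-ancestor-< h (false ∷ m) b     r = s≤s (pre-ancestor-< (h ∸ 1) m b r)
pre-ancestor-< h (true ∷ m)  b     r = +-monoʳ-< (2 ^ (h ∸ 1)) (pre-ancestor-< (h ∸ 1) m b r)

pre-ancestor-≤ : ∀ h m s → pre h m ≤ pre h (m ++ s)
pre-ancestor-≤ h m []      = ≤-reflexive (cong (pre h) (sym (++-identityʳ m)))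
pre-ancestor-≤ h m (b ∷ s) = <⇒≤ (pre-ancestor-< h m b s)

pre-∷ʳ-≤ : ∀ h m b r → pre h (m ++ b ∷ []) ≤ pre h (m ++ b ∷ r)
pre-∷ʳ-≤ h m b r =
  subst (pre h (m ++ b ∷ []) ≤_) (cong (pre h) (++-assoc m (b ∷ []) r)) (pre-ancestor-≤ h (m ++ b ∷ []) r)

-- A subtree of height g has 2 ^ g ∸ 1 vertices.
suc-pre<2^ : ∀ g r → length r < g → suc (pre g r) < 2 ^ g
suc-pre<2^ (suc g) []          _       = +-mono-≤ (m^n>0 2 g) (≤-trans (m^n>0 2 g) (m≤m+n _ 0))
suc-pre<2^ (suc g) (false ∷ r) (s≤s l) =
  ≤-trans (+-mono-≤ (m^n>0 2 g) (suc-pre<2^ g r l)) (+-monoʳ-≤ (2 ^ g) (m≤m+n (2 ^ g) 0))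
suc-pre<2^ (suc g) (true ∷ r)  (s≤s l) = begin
  2 + (2 ^ g + pre g r)  ≡⟨ sym (trans (+-suc (2 ^ g) (suc (pre g r))) (cong suc (+-suc (2 ^ g) (pre g r)))) ⟩
  2 ^ g + (2 + pre g r)  ≤⟨ +-monoʳ-≤ (2 ^ g) (suc-pre<2^ g r l) ⟩
  2 ^ g + 2 ^ g          ≤⟨ +-monoʳ-≤ (2 ^ g) (m≤m+n (2 ^ g) 0) ⟩
  2 ^ suc g              ∎
  where open ≤-Reasoning

pre-left<right : ∀ h m r r' → length (m ++ false ∷ r) < h →
                 pre h (m ++ false ∷ r) < pre h (m ++ true ∷ r')
pre-left<right (suc g) []          r r' (s≤s l) = ≤-trans (suc-pre<2^ g r l) (m≤m+n _ _)
pre-left<right (suc g) (false ∷ m) r r' (s≤s l) = s≤s (pre-left<right g m r r' l)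
pre-left<right (suc g) (true ∷ m)  r r' (s≤s l) = +-monoʳ-< (2 ^ g) (pre-left<right g m r r' l)

pre-leftTree<right : ∀ h m r s r' → length ((m ++ false ∷ r) ++ s) < h →
                     pre h ((m ++ false ∷ r) ++ s) < pre h (m ++ true ∷ r')
pre-leftTree<right h m r s r' v rewrite ++-assoc m (false ∷ r) s = pre-left<right h m (r ++ s) r' v

data Position : Vertex → Vertex → Set where
  same    : ∀ {v} → Position v v
  below   : ∀ v b s → Position (v ++ b ∷ s) v
  above   : ∀ u b s → Position u (u ++ b ∷ s)
  leftOf  : ∀ m r r' → Position (m ++ false ∷ r) (m ++ true ∷ r')
  rightOf : ∀ m r r' → Position (m ++ true ∷ r) (m ++ false ∷ r')

∷-Position : ∀ b {u v} → Position u v → Position (b ∷ u) (b ∷ v)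
∷-Position b same             = same
∷-Position b (below v c s)    = below (b ∷ v) c s
∷-Position b (above u c s)    = above (b ∷ u) c s
∷-Position b (leftOf m r r')  = leftOf (b ∷ m) r r'
∷-Position b (rightOf m r r') = rightOf (b ∷ m) r r'

position : ∀ u v → Position u v
position []          []          = same
position []          (b ∷ s)     = above [] b s
position (b ∷ s)     []          = below [] b s
position (false ∷ u) (false ∷ v) = ∷-Position false (position u v)
position (true ∷ u)  (true ∷ v)  = ∷-Position true (position u v)
position (false ∷ u) (true ∷ v)  = leftOf [] u v
position (true ∷ u)  (false ∷ v) = rightOf [] u v

module _ (H : ℕ) where

  Higher-irrefl : ∀ {u} → ¬ Higher H u u
  Higher-irrefl (inj₁ lt)       = <-irrefl refl lt
  Higher-irrefl (inj₂ (_ , lt)) = <-irrefl refl lt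

  Higher⇒≢ : ∀ {u v} → Higher H u v → ¬ u ≡ v
  Higher⇒≢ {u} h refl = Higher-irrefl {u} h

  Higher-asym : ∀ {u v} → Higher H u v → ¬ Higher H v u
  Higher-asym (inj₁ a)       (inj₁ b)       = <-asym a b
  Higher-asym (inj₁ a)       (inj₂ (e , _)) = <-irrefl (sym e) a
  Higher-asym (inj₂ (e , _)) (inj₁ b)       = <-irrefl (sym e) b
  Higher-asym (inj₂ (_ , a)) (inj₂ (_ , b)) = <-asym a b

  Higher-intro : ∀ {x y} → depth x ≤ depth y → pre H y < pre H x → Higher H x y
  Higher-intro le lt with m≤n⇒m<n∨m≡n le
  ... | inj₁ shallower = inj₁ shallower
  ... | inj₂ level     = inj₂ (level , lt)

  Higher-ancestor : ∀ u b s → Higher H u (u ++ b ∷ s)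
  Higher-ancestor u b s = inj₁ (length-<-++-∷ u b s)

  Higher-right-of-left : ∀ m r → IsVertex H (m ++ false ∷ r) → Higher H (m ++ true ∷ []) (m ++ false ∷ r)
  Higher-right-of-left m []      v = inj₂ (length-swap m true false [] , pre-left<right H m [] [] v)
  Higher-right-of-left m (c ∷ r) _ = inj₁ (length-∷ʳ< m true false c r)

  highest-unbeaten : ∀ {i j k} x → IsHighest H i j k → InInterval H i j x → ¬ Higher H x k
  highest-unbeaten {k = k} x (_ , top) xI h = Higher-asym {x} {k} h (top x xI (Higher⇒≢ {x} {k} h))

  siblings-adjacent : ∀ p → IsVertex H (p ++ true ∷ []) →
                      LeftLevelNeighbour H (p ++ false ∷ []) (p ++ true ∷ [])
  siblings-adjacent p kv = av , kv , length-swap p false true [] , pre-left<right H p [] [] av , noneBetween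
    where
      av = subst (_< H) (length-swap p true false []) kv
      noneBetween : ∀ w → IsVertex H w → depth w ≡ depth (p ++ true ∷ []) →
                    ¬ (pre H (p ++ false ∷ []) < pre H w × pre H w < pre H (p ++ true ∷ []))
      noneBetween w wv dw (lo , hi) with position w p
      ... | same                  = <-irrefl dw (length-<-++-∷ p true [])
      ... | above _ b s           =
        <-irrefl dw (<-≤-trans (length-<-++-∷ w b s) (length-≤-++ (w ++ b ∷ s) (true ∷ [])))
      ... | below _ false []      = <-irrefl refl lo
      ... | below _ false (c ∷ s) = <-irrefl (sym dw) (length-∷ʳ< p true false c s)
      ... | below _ true s        = <⇒≱ hi (pre-∷ʳ-≤ H p true s)
      ... | leftOf m r r'         =
        <-asym lo (<-trans (pre-left<right H m r r' wv) (pre-ancestor-< H (m ++ true ∷ r') false []))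
      ... | rightOf m r r'        =
        <-asym hi (pre-leftTree<right H m r' (true ∷ []) r kv)

  ancestor-∈ : ∀ {i j} x s → i ≤ pre H x → InInterval H i j (x ++ s) → InInterval H i j x
  ancestor-∈ x s ix (v , _ , xj) =
    ≤-<-trans (length-≤-++ x s) v , ix , ≤-trans (pre-ancestor-≤ H x s) xj

  rightBranch-∈ : ∀ {i j} m r r' → InInterval H i j (m ++ false ∷ r) →
                  InInterval H i j (m ++ true ∷ r') → InInterval H i j (m ++ true ∷ [])
  rightBranch-∈ m r r' (av , ia , _) (cv , _ , cj) =
    xv , ≤-trans ia (<⇒≤ (pre-left<right H m r [] av)) , ≤-trans (pre-∷ʳ-≤ H m true r') cj
    where xv = ≤-<-trans (length-∷ʳ≤ m m true true r' refl) cv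

  leftChild-∈ : ∀ {i j} k b r → i ≤ pre H k → InInterval H i j (k ++ b ∷ r) →
                InInterval H i j (k ++ false ∷ [])
  leftChild-∈ k b r ik (zv , _ , zj) =
    xv , ≤-trans ik (<⇒≤ (pre-ancestor-< H k false [])) , ≤-trans (leftChild≤ b) zj
    where
      xv = ≤-<-trans (length-∷ʳ≤ k k false b r refl) zv
      leftChild≤ : ∀ b → pre H (k ++ false ∷ []) ≤ pre H (k ++ b ∷ r)
      leftChild≤ false = pre-∷ʳ-≤ H k false r
      leftChild≤ true  = <⇒≤ (pre-left<right H k [] r xv)

  ruleAdj : ∀ {c u} → IsVertex H c → IsVertex H u → ¬ u ≡ c → Rule H c u → Adj H c u
  ruleAdj cv uv u≢c r = cv , uv , (λ e → u≢c (sym e)) , inj₁ r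

  edgeToParent : ∀ {v u} → ParentOf u v → Rule H v u
  edgeToParent x = inj₂ (inj₁ x)

  E1 : ∀ {v u} → InSubtree u v → Rule H v u
  E1 x = inj₂ (inj₂ (inj₁ x))

  E2 : ∀ {v u} w → LevelNeighbour H w v → InSubtree u w → Rule H v u
  E2 w n x = inj₂ (inj₂ (inj₂ (inj₁ (w , n , x))))

  E3 : ∀ {v u} q p → ParentOf q v → LeftLevelNeighbour H p q → InSubtree u p → Rule H v u
  E3 q p a n x = inj₂ (inj₂ (inj₂ (inj₂ (q , p , a , n , x))))

  data Cover (k u : Vertex) : Set where
    inTree        : InSubtree u k → Cover k u
    inLeftSibling : ∀ p → k ≡ p ++ true ∷ [] → InSubtree u (p ++ false ∷ []) → Cover k u

  -- In the excluded positions the right child m ++ [true] of the branch point beats k.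
  highest-cover : ∀ {i j k u} → IsHighest H i j k → InInterval H i j u → Cover k u
  highest-cover {k = k} {u} hk uI with position u k
  ... | same                 = inTree ([] , sym (++-identityʳ k))
  ... | below _ b s          = inTree (b ∷ s , refl)
  ... | above _ b s          = ⊥-elim (highest-unbeaten u hk uI (Higher-ancestor u b s))
  ... | leftOf m r []        = inLeftSibling m refl (InSubtree-child m false r)
  ... | leftOf m r (c ∷ r')  =
    ⊥-elim (highest-unbeaten (m ++ true ∷ []) hk (rightBranch-∈ m r (c ∷ r') uI (proj₁ hk))
              (inj₁ (length-∷ʳ< m true true c r')))
  ... | rightOf m r r'       =
    ⊥-elim (highest-unbeaten (m ++ true ∷ []) hk (rightBranch-∈ m r' r (proj₁ hk) uI)
              (Higher-right-of-left m r' (proj₁ (proj₁ hk))))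

  leftSibling-pre< : ∀ {k u} p → k ≡ p ++ true ∷ [] → InSubtree u (p ++ false ∷ []) → IsVertex H u → pre H u < pre H k
  leftSibling-pre< p refl (t , refl) uv = pre-leftTree<right H p [] t [] uv

  highest-spanningStar : ∀ {i j k} → IsHighest H i j k → SpanningStar H i j k
  highest-spanningStar {i} {j} {k} hk = proj₁ hk , star
    where
      kv = proj₁ (proj₁ hk)
      star : ∀ u → InInterval H i j u → ¬ u ≡ k → Adj H k u
      star u uI u≢k with highest-cover hk uI
      ... | inTree ut               = ruleAdj kv (proj₁ uI) u≢k (E1 ut)
      ... | inLeftSibling p refl ua =
        ruleAdj kv (proj₁ uI) u≢k (E2 (p ++ false ∷ []) (inj₁ (siblings-adjacent p kv)) ua)

  IsHighestBelow : ℕ → ℕ → Vertex → Vertex → Set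
  IsHighestBelow i j k z =
    ∀ b r → InInterval H i j (k ++ b ∷ r) → ¬ k ++ b ∷ r ≡ z → Higher H z (k ++ b ∷ r)

  highestBelow-unbeaten : ∀ {i j k z} b r → IsHighestBelow i j k z → InInterval H i j (k ++ b ∷ r) →
                          ¬ Higher H (k ++ b ∷ r) z
  highestBelow-unbeaten {k = k} {z} b r top xI h =
    Higher-asym {k ++ b ∷ r} {z} h (top b r xI (Higher⇒≢ {k ++ b ∷ r} {z} h))

  data TopChild (i j : ℕ) (k : Vertex) : Vertex → Set where
    right : TopChild i j k (k ++ true ∷ [])
    left  : (∀ u → InInterval H i j u → ¬ InSubtree u (k ++ true ∷ [])) → TopChild i j k (k ++ false ∷ [])

  highestBelow-child : ∀ {i j} k b r → i ≤ pre H k → InInterval H i j (k ++ b ∷ r) →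
                       IsHighestBelow i j k (k ++ b ∷ r) → TopChild i j k (k ++ b ∷ r)
  highestBelow-child k true  []      _  _  _   = right
  highestBelow-child {i} {j} k false [] ik zI top = left noRight
    where
      noRight : ∀ u → InInterval H i j u → ¬ InSubtree u (k ++ true ∷ [])
      noRight u uI (t , refl) = highestBelow-unbeaten true [] top rI
        (Higher-right-of-left k [] (subst (_< H) (length-swap k true false []) (proj₁ rI)))
        where rI = ancestor-∈ (k ++ true ∷ []) t (≤-trans ik (<⇒≤ (pre-ancestor-< H k true []))) uI
  highestBelow-child k b (c ∷ r) ik zI top =
    ⊥-elim (highestBelow-unbeaten false [] top (leftChild-∈ k b (c ∷ r) ik zI)
              (inj₁ (length-∷ʳ< k false b c r)))

  topChild-parent : ∀ {i j k z} → TopChild i j k z → ParentOf k z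
  topChild-parent right    = true , refl
  topChild-parent (left _) = false , refl

  topChild-rule : ∀ {i j k z u} → TopChild i j k z → IsVertex H z → InInterval H i j u → InSubtree u k → Rule H z u
  topChild-rule {k = k} {z} zc zv uI ([] , refl) =
    edgeToParent (subst (λ x → ParentOf x z) (sym (++-identityʳ k)) (topChild-parent zc))
  topChild-rule {k = k} right      zv uI (false ∷ s , refl) =
    E2 (k ++ false ∷ []) (inj₁ (siblings-adjacent k zv)) (InSubtree-child k false s)
  topChild-rule {k = k} right      zv uI (true ∷ s , refl)  = E1 (InSubtree-child k true s)
  topChild-rule {k = k} (left _)   zv uI (false ∷ s , refl) = E1 (InSubtree-child k false s)
  topChild-rule {k = k} (left noR) zv uI (true ∷ s , refl)  = ⊥-elim (noR _ uI (InSubtree-child k true s))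

  topChild-spanningStar : ∀ {i j k z} → IsHighest H i j k → TopChild i j k z → InInterval H i j z →
                          SpanningStar H i j z
  topChild-spanningStar {i} {j} {k} {z} hk zc zI = zI , star
    where
      zv = proj₁ zI
      star : ∀ u → InInterval H i j u → ¬ u ≡ z → Adj H z u
      star u uI u≢z with highest-cover hk uI
      ... | inTree ut = ruleAdj zv (proj₁ uI) u≢z (topChild-rule zc zv uI ut)
      ... | inLeftSibling p refl ua =
        ruleAdj zv (proj₁ uI) u≢z
          (E3 k (p ++ false ∷ []) (topChild-parent zc) (siblings-adjacent p (proj₁ (proj₁ hk))) ua)

  secondHighest-highestBefore : ∀ {i j k s} → IsSecondHighest H i j k s → pre H s < pre H k →
                                IsHighest H i (pred (pre H k)) s
  secondHighest-highestBefore {k = k} (((_ , _ , kj) , _) , (sv , is , _) , _ , top) s<k =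
    (sv , is , suc[m]≤n⇒m≤pred[n] s<k) ,
    λ w (wv , iw , wk) w≢s → top w (wv , iw , ≤-trans (≤pred⇒≤ wk) kj) (w≢k w wk) w≢s
    where
      w≢k : ∀ w → pre H w ≤ pred (pre H k) → ¬ w ≡ k
      w≢k w wk refl = <-irrefl refl (m≤pred[n]⇒suc[m]≤n {{>-nonZero (≤-<-trans z≤n s<k)}} wk)

  -- The left child of the highest vertex would beat the second highest.
  secondHighest-belowLeftSibling : ∀ {i j} p d t c r →
    IsSecondHighest H i j (p ++ true ∷ []) ((p ++ false ∷ []) ++ d ∷ t) →
    ¬ InInterval H i j ((p ++ true ∷ []) ++ c ∷ r)
  secondHighest-belowLeftSibling p d t c r (hk , sI , _ , top) uI =
    Higher-asym {s} {x} (top x xI (descendant-≢ k false []) (Higher⇒≢ {x} {s} x>s)) x>s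
    where
      k = p ++ true ∷ []
      s = (p ++ false ∷ []) ++ d ∷ t
      x = k ++ false ∷ []
      xI = leftChild-∈ k c r (proj₁ (proj₂ (proj₁ hk))) uI
      x>s : Higher H x s
      x>s = Higher-intro {x} {s} (length-∷ʳ≤ k (p ++ false ∷ []) false d t (length-swap p true false []))
              (<-trans (pre-leftTree<right H p [] (d ∷ t) [] (proj₁ sI)) (pre-ancestor-< H k false []))

  leftSibling-adjacentInTree : ∀ {i j p s u} → IsSecondHighest H i j (p ++ true ∷ []) s →
    InSubtree s (p ++ false ∷ []) → InSubtree u (p ++ true ∷ []) → InInterval H i j u → ¬ u ≡ s → Adj H s u
  leftSibling-adjacentInTree {p = p} {u = u} (hk , sI , _ , _) ([] , e) ut uI u≢s =
    subst (λ x → Adj H x u) (sym s≡a)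
      (ruleAdj av (proj₁ uI) (λ eq → u≢s (trans eq (sym s≡a)))
        (E2 (p ++ true ∷ []) (inj₂ (siblings-adjacent p (proj₁ (proj₁ hk)))) ut))
    where
      s≡a = trans e (++-identityʳ (p ++ false ∷ []))
      av = subst (IsVertex H) s≡a (proj₁ sI)
  leftSibling-adjacentInTree {p = p} {s} {u} (hk , sI , s≢k , _) (d ∷ t , refl) ([] , e) uI u≢s =
    subst (Adj H s) (sym u≡k)
      (proj₁ sI , kv , s≢k ,
       inj₂ (E2 (p ++ false ∷ []) (inj₁ (siblings-adjacent p kv)) (d ∷ t , refl)))
    where
      u≡k = trans e (++-identityʳ (p ++ true ∷ []))
      kv = proj₁ (proj₁ hk)
  leftSibling-adjacentInTree {p = p} sh (d ∷ t , refl) (c ∷ r , refl) uI _ =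
    ⊥-elim (secondHighest-belowLeftSibling p d t c r sh uI)

  leftSibling-spanningStar : ∀ {i j p s} → IsSecondHighest H i j (p ++ true ∷ []) s →
                             InSubtree s (p ++ false ∷ []) → SpanningStar H i j s
  leftSibling-spanningStar {i} {j} {p} {s} sh@(hk , sI , _ , _) sa = sI , star
    where
      before = highest-spanningStar (secondHighest-highestBefore sh (leftSibling-pre< p refl sa (proj₁ sI)))
      star : ∀ u → InInterval H i j u → ¬ u ≡ s → Adj H s u
      star u uI u≢s with highest-cover hk uI
      ... | inTree ut = leftSibling-adjacentInTree sh sa ut uI u≢s
      ... | inLeftSibling p' e ua =
        proj₂ before u
          (proj₁ uI , proj₁ (proj₂ uI) , suc[m]≤n⇒m≤pred[n] (leftSibling-pre< p' e ua (proj₁ uI))) u≢s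

  highestBelow-spanningStar : ∀ {i j} k b r → IsHighest H i j k → InInterval H i j (k ++ b ∷ r) →
                              IsHighestBelow i j k (k ++ b ∷ r) → SpanningStar H i j (k ++ b ∷ r)
  highestBelow-spanningStar k b r hk zI top =
    topChild-spanningStar hk (highestBelow-child k b r (proj₁ (proj₂ (proj₁ hk))) zI top) zI

  secondHighest-spanningStar : ∀ {i j k s} → IsSecondHighest H i j k s → SpanningStar H i j s
  secondHighest-spanningStar {k = k} sh@(hk , sI , s≢k , top) with highest-cover hk sI
  ... | inTree ([] , e)         = ⊥-elim (s≢k (trans e (++-identityʳ k)))
  ... | inTree (b ∷ r , refl)   =
    highestBelow-spanningStar k b r hk sI (λ b′ r′ xI → top _ xI (descendant-≢ k b′ r′))
  ... | inLeftSibling p refl sa = leftSibling-spanningStar sh sa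

  nextHighest-after : ∀ {j} k {w} → IsHighest H (pre H k + 1) j w → pre H k < pre H w
  nextHighest-after k {w} ((_ , kw , _) , _) = subst (_≤ pre H w) (+-comm (pre H k) 1) kw

  nextHighest-∈ : ∀ {i j k w} → IsHighest H i j k → IsHighest H (pre H k + 1) j w → InInterval H i j w
  nextHighest-∈ {k = k} hk hw@((wv , _ , wj) , _) =
    wv , ≤-trans (proj₁ (proj₂ (proj₁ hk))) (<⇒≤ (nextHighest-after k hw)) , wj

  nextHighest-spanningStar : ∀ {i j k w} → IsHighest H i j k → IsHighest H (pre H k + 1) j w →
                             SpanningStar H i j w
  nextHighest-spanningStar {k = k} {w} hk hw with highest-cover {u = w} hk (nextHighest-∈ hk hw)
  ... | inTree ([] , refl) = ⊥-elim (<-irrefl (cong (pre H) (sym (++-identityʳ k))) (nextHighest-after k hw))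
  ... | inTree (b ∷ r , refl) =
    highestBelow-spanningStar k b r hk (nextHighest-∈ hk hw)
      (λ b′ r′ (xv , _ , xj) → proj₂ hw _
         (xv , subst (_≤ pre H (k ++ b′ ∷ r′)) (+-comm 1 (pre H k)) (pre-ancestor-< H k b′ r′) , xj))
  ... | inLeftSibling p refl wa =
    ⊥-elim (<-asym (nextHighest-after k hw) (leftSibling-pre< p refl wa (proj₁ (proj₁ hw))))

lemma1 : (H : ℕ) → 2 ≤ H → (i j : ℕ) → i < j → j < 2 ^ H ∸ 1 →
    ((k : Vertex) → IsHighest H i j k → SpanningStar H i j k) ×
    ((k s : Vertex) → IsSecondHighest H i j k s → SpanningStar H i j s) ×
    ((k w : Vertex) → IsHighest H i j k → xc H k < j →
       IsHighest H (xc H k + 1) j w → SpanningStar H i j w)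
-- None of the numeric hypotheses is needed; xc H k < j is implied by the existence of w.
lemma1 H _ _ _ _ _ =
  (λ _ → highest-spanningStar H) ,
  (λ _ _ → secondHighest-spanningStar H) ,
  (λ _ _ hk _ → nextHighest-spanningStar H hk)
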